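{- The clique number is stable under 2-switch: for every graph $G$ and every 2-switch $\tau$, $|\omega(\tau(G))-\omega(G)|\le 1$.
   Context: Graphs are finite, simple, undirected and labeled. $\omega(G)$ is the maximum order of a complete subgraph of $G$. For vertices $a,b,c,d$, the 2-switch $\tau=\binom{a\ b}{c\ d}$ maps $G$ to $G-ab-cd+ac+bd$ if $ab,cd\in E(G)$, $\{a,b\}\cap\{c,d\}=\varnothing$ and $ac,bd\notin E(G)$, and to $G$ otherwise. -}

module Defs where

open import Data.Bool using (Bool; true; false; _∧_; _∨_; not; if_then_else_)
open import Data.Nat using (ℕ; zero; suc; _⊔_)
open import Data.Fin using (Fin; _≟_)
open import Data.Fin.Subset using (Subset; Side; inside; outside; ∣_∣)
open import Data.Vec using (Vec; []; _∷_; lookup)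
open import Data.List using (List; []; _∷_; map; _++_; foldr; allFin)
open import Relation.Nullary using (yes; no)
open import Relation.Nullary.Decidable using (⌊_⌋)
open import Relation.Binary.PropositionalEquality using (_≡_; refl; sym; trans; cong)

record Graph (n : ℕ) : Set where
  field
    adj    : Fin n → Fin n → Bool
    adj-sym    : ∀ x y → adj x y ≡ adj y x
    adj-irrefl : ∀ x → adj x x ≡ false
open Graph public

_==_ : ∀ {n} → Fin n → Fin n → Bool
x == y = ⌊ x ≟ y ⌋

==-sym : ∀ {n} (x y : Fin n) → (x == y) ≡ (y == x)
==-sym x y with x ≟ y | y ≟ x
... | yes _ | yes _ = refl
... | no _  | no _  = refl
... | yes p | no q  with q (sym p)
... | ()
==-sym x y | no q | yes p with q (sym p)
... | ()

samePair : ∀ {n} → Fin n → Fin n → Fin n → Fin n → Bool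
samePair x y u v = ((x == u) ∧ (y == v)) ∨ ((x == v) ∧ (y == u))

private
  swapBool : ∀ (p q r s : Bool) → ((p ∧ q) ∨ (r ∧ s)) ≡ ((s ∧ r) ∨ (q ∧ p))
  swapBool false false false false = refl
  swapBool false false false true = refl
  swapBool false false true false = refl
  swapBool false false true true = refl
  swapBool false true false false = refl
  swapBool false true false true = refl
  swapBool false true true false = refl
  swapBool false true true true = refl
  swapBool true false false false = refl
  swapBool true false false true = refl
  swapBool true false true false = refl
  swapBool true false true true = refl
  swapBool true true false false = refl
  swapBool true true false true = refl
  swapBool true true true false = refl
  swapBool true true true true = refl

samePair-sym : ∀ {n} (x y u v : Fin n) → samePair x y u v ≡ samePair y x u v
samePair-sym x y u v
  rewrite swapBool (x == u) (y == v) (x == v) (y == u) = refl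

applicable : ∀ {n} → Graph n → Fin n → Fin n → Fin n → Fin n → Bool
applicable G a b c d =
  adj G a b ∧ adj G c d
  ∧ not (a == c) ∧ not (a == d) ∧ not (b == c) ∧ not (b == d)
  ∧ not (adj G a c) ∧ not (adj G b d)

switchedAdj : ∀ {n} → Graph n → Fin n → Fin n → Fin n → Fin n → Fin n → Fin n → Bool
switchedAdj G a b c d x y =
  if x == y then false
  else if samePair x y a b ∨ samePair x y c d then false
  else if samePair x y a c ∨ samePair x y b d then true
  else adj G x y

switched : ∀ {n} → Graph n → Fin n → Fin n → Fin n → Fin n → Graph n
switched G a b c d = record
  { adj    = switchedAdj G a b c d
  ; adj-sym    = λ x y → symm x y
  ; adj-irrefl = λ x → irr x
  }
  where
  irr : ∀ x → switchedAdj G a b c d x x ≡ false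
  irr x with x ≟ x
  ... | yes _ = refl
  ... | no ¬p with ¬p refl
  ... | ()
  symm : ∀ x y → switchedAdj G a b c d x y ≡ switchedAdj G a b c d y x
  symm x y
    rewrite ==-sym x y
          | samePair-sym x y a b | samePair-sym x y c d
          | samePair-sym x y a c | samePair-sym x y b d
          | Graph.adj-sym G x y = refl

twoSwitch : ∀ {n} → Fin n → Fin n → Fin n → Fin n → Graph n → Graph n
twoSwitch a b c d G =
  if applicable G a b c d then switched G a b c d else G

allSubsets : ∀ n → List (Subset n)
allSubsets zero    = [] ∷ []
allSubsets (suc n) =
  map (inside ∷_) (allSubsets n) ++ map (outside ∷_) (allSubsets n)

isIn : ∀ {n} → Subset n → Fin n → Bool
isIn S i with lookup S i
... | inside  = true
... | outside = false

allᵇ : ∀ {A : Set} → (A → Bool) → List A → Bool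
allᵇ p = foldr (λ x r → p x ∧ r) true

isClique : ∀ {n} → Graph n → Subset n → Bool
isClique {n} G S =
  allᵇ (λ i → allᵇ (λ j → not (isIn S i ∧ isIn S j ∧ not (i == j)) ∨ adj G i j)
                 (allFin n))
      (allFin n)

ω : ∀ {n} → Graph n → ℕ
ω {n} G = foldr (λ S m → (if isClique G S then ∣ S ∣ else 0) ⊔ m) 0 (allSubsets n)

-- A clique K of G loses at most one vertex in τ(G): if b ∈ K then d ∉ K (bd is a
-- non-edge), so ab is the only removed edge inside K and deleting a leaves a clique
-- of τ(G); if b ∉ K, the removed edge ab is not inside K and deleting c leaves a
-- clique. Hence ω(G) ≤ ω(τ(G)) + 1. Symmetrically the added edges ac and bd of τ(G)
-- are joined by the non-edge ab of τ(G), so ω(τ(G)) ≤ ω(G) + 1.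
module Submission where

open import Defs
open import Data.Bool using (Bool; true; false; _∧_; _∨_; not; if_then_else_)
open import Data.Fin using (Fin; zero; suc; _≟_)
open import Data.Fin.Subset using (Subset; inside; outside; ∣_∣; _∈_; _∉_; _⊆_)
open import Data.Fin.Subset.Properties using (_∈?_)
open import Data.List using ([]; _∷_; map; foldr; allFin)
open import Data.List.Membership.Propositional using () renaming (_∈_ to _∈ᴸ_)
open import Data.List.Membership.Propositional.Properties using (∈-allFin; ∈-map⁺; ∈-++⁺ˡ; ∈-++⁺ʳ)
open import Data.List.Relation.Unary.Any using (here; there)
open import Data.Nat using (ℕ; _≤_; _⊔_; ∣_-_∣; zero; suc; z≤n; s≤s)
open import Data.Nat.Properties using (≤-refl; ≤-trans; n≤1+n; ⊔-lub; m≤m⊔n; m≤n⊔m; ∣n-n∣≡0)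
open import Data.Product using (Σ; _×_; _,_; proj₁; proj₂)
open import Data.Sum using (_⊎_; inj₁; inj₂)
open import Data.Vec using ([]; _∷_; lookup; here; there; _[_]≔_)
open import Data.Vec.Properties using ([]=⇒lookup; lookup⇒[]=; []≔-updates)
open import Relation.Binary.PropositionalEquality using (_≡_; _≢_; refl; sym; trans; cong; subst)
open import Relation.Nullary using (¬_; yes; no; contradiction)

∧≡true⇒ : ∀ {x y} → x ∧ y ≡ true → x ≡ true × y ≡ true
∧≡true⇒ {true} {true} _ = refl , refl

∨≡true⇒ : ∀ {x y} → x ∨ y ≡ true → x ≡ true ⊎ y ≡ true
∨≡true⇒ {true}  _ = inj₁ refl
∨≡true⇒ {false} e = inj₂ e

not≡true⇒ : ∀ {x} → not x ≡ true → x ≡ false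
not≡true⇒ {false} _ = refl

==⇒≡ : ∀ {n} {x y : Fin n} → (x == y) ≡ true → x ≡ y
==⇒≡ {x = x} {y} e with x ≟ y
... | yes x≡y = x≡y

==≡false⇒≢ : ∀ {n} {x y : Fin n} → (x == y) ≡ false → x ≢ y
==≡false⇒≢ {x = x} e refl with x ≟ x
... | no x≢x = x≢x refl

≢⇒==≡false : ∀ {n} {x y : Fin n} → x ≢ y → (x == y) ≡ false
≢⇒==≡false {x = x} {y} x≢y with x ≟ y
... | yes x≡y = contradiction x≡y x≢y
... | no _    = refl

==-refl : ∀ {n} (x : Fin n) → (x == x) ≡ true
==-refl x with x ≟ x
... | yes _   = refl
... | no x≢x = contradiction refl x≢x

adjacent⇒≢ : ∀ {n} (G : Graph n) {x y} → adj G x y ≡ true → x ≢ y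
adjacent⇒≢ G {x} xy∈G refl with trans (sym (adj-irrefl G x)) xy∈G
... | ()

SamePair : ∀ {n} → Fin n → Fin n → Fin n → Fin n → Set
SamePair i j u v = (i ≡ u × j ≡ v) ⊎ (i ≡ v × j ≡ u)

SamePair-sym : ∀ {n} {i j u v : Fin n} → SamePair i j u v → SamePair i j v u
SamePair-sym (inj₁ (i≡u , j≡v)) = inj₂ (i≡u , j≡v)
SamePair-sym (inj₂ (i≡v , j≡u)) = inj₁ (i≡v , j≡u)

==∧==⇒ : ∀ {n} {i j u v : Fin n} → (i == u) ∧ (j == v) ≡ true → i ≡ u × j ≡ v
==∧==⇒ e with ∧≡true⇒ e
... | i==u , j==v = ==⇒≡ i==u , ==⇒≡ j==v

samePair⇒SamePair : ∀ {n} {i j u v : Fin n} → samePair i j u v ≡ true → SamePair i j u v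
samePair⇒SamePair e with ∨≡true⇒ e
... | inj₁ i==u∧j==v = inj₁ (==∧==⇒ i==u∧j==v)
... | inj₂ i==v∧j==u = inj₂ (==∧==⇒ i==v∧j==u)

IsClique : ∀ {n} → Graph n → Subset n → Set
IsClique {n} G K = ∀ {i j : Fin n} → i ∈ K → j ∈ K → i ≢ j → adj G i j ≡ true

isIn≡lookup : ∀ {n} (K : Subset n) i → isIn K i ≡ lookup K i
isIn≡lookup K i with lookup K i
... | inside  = refl
... | outside = refl

allᵇ≡true⇒ : ∀ {A : Set} {p : A → Bool} {xs x} → allᵇ p xs ≡ true → x ∈ᴸ xs → p x ≡ true
allᵇ≡true⇒ e (here refl) = ∧≡true⇒ e .proj₁
allᵇ≡true⇒ e (there x∈xs) = allᵇ≡true⇒ (∧≡true⇒ e .proj₂) x∈xs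

allᵇ≡true⁺ : ∀ {A : Set} {p : A → Bool} xs → (∀ x → p x ≡ true) → allᵇ p xs ≡ true
allᵇ≡true⁺ []       _  = refl
allᵇ≡true⁺ (x ∷ xs) px rewrite px x = allᵇ≡true⁺ xs px

isClique⇒IsClique : ∀ {n} (G : Graph n) K → isClique G K ≡ true → IsClique G K
isClique⇒IsClique G K e {i} {j} i∈K j∈K i≢j =
  guarded (allᵇ≡true⇒ (allᵇ≡true⇒ e (∈-allFin i)) (∈-allFin j))
          (trans (isIn≡lookup K i) ([]=⇒lookup i∈K))
          (trans (isIn≡lookup K j) ([]=⇒lookup j∈K))
          (≢⇒==≡false i≢j)
  where
  guarded : ∀ {x y z w} → not (x ∧ y ∧ not z) ∨ w ≡ true → x ≡ true → y ≡ true → z ≡ false → w ≡ true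
  guarded e refl refl refl = e

IsClique⇒isClique : ∀ {n} (G : Graph n) K → IsClique G K → isClique G K ≡ true
IsClique⇒isClique {n} G K K-clique = allᵇ≡true⁺ (allFin n) λ i → allᵇ≡true⁺ (allFin n) λ j →
  guarded (isIn K i) (isIn K j) (i == j) λ i∈K j∈K i≢j →
    K-clique (lookup⇒[]= i K (trans (sym (isIn≡lookup K i)) i∈K))
             (lookup⇒[]= j K (trans (sym (isIn≡lookup K j)) j∈K))
             (==≡false⇒≢ i≢j)
  where
  guarded : ∀ x y z {w} → (x ≡ true → y ≡ true → z ≡ false → w ≡ true) → not (x ∧ y ∧ not z) ∨ w ≡ true
  guarded true  true  false f = f refl refl refl
  guarded true  true  true  _ = refl
  guarded true  false _     _ = refl
  guarded false _     _     _ = refl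

allSubsets-complete : ∀ {n} (K : Subset n) → K ∈ᴸ allSubsets n
allSubsets-complete []                  = here refl
allSubsets-complete {suc n} (inside ∷ K)  = ∈-++⁺ˡ (∈-map⁺ (inside ∷_) (allSubsets-complete K))
allSubsets-complete {suc n} (outside ∷ K) =
  ∈-++⁺ʳ (map (inside ∷_) (allSubsets n)) (∈-map⁺ (outside ∷_) (allSubsets-complete K))

≤-foldr-⊔ : ∀ {A : Set} (f : A → ℕ) {xs x} → x ∈ᴸ xs → f x ≤ foldr (λ y m → f y ⊔ m) 0 xs
≤-foldr-⊔ f {y ∷ _} (here refl)  = m≤m⊔n (f y) _
≤-foldr-⊔ f {y ∷ _} (there x∈xs) = ≤-trans (≤-foldr-⊔ f x∈xs) (m≤n⊔m (f y) _)

foldr-⊔-lub : ∀ {A : Set} (f : A → ℕ) {m} xs → (∀ {x} → x ∈ᴸ xs → f x ≤ m) → foldr (λ y k → f y ⊔ k) 0 xs ≤ m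
foldr-⊔-lub f []       _   = z≤n
foldr-⊔-lub f (x ∷ xs) f≤m = ⊔-lub (f≤m (here refl)) (foldr-⊔-lub f xs (λ x∈xs → f≤m (there x∈xs)))

∣clique∣≤ω : ∀ {n} (G : Graph n) {K} → IsClique G K → ∣ K ∣ ≤ ω G
∣clique∣≤ω {n} G {K} K-clique =
  subst (_≤ ω G) (cong (λ b → if b then ∣ K ∣ else 0) (IsClique⇒isClique G K K-clique))
    (≤-foldr-⊔ (λ L → if isClique G L then ∣ L ∣ else 0) (allSubsets-complete K))

ω-lub : ∀ {n} (G : Graph n) {m} → (∀ K → IsClique G K → ∣ K ∣ ≤ m) → ω G ≤ m
ω-lub {n} G {m} bound = foldr-⊔-lub _ (allSubsets n) λ {K} _ → clique-term K
  where
  clique-term : ∀ K → (if isClique G K then ∣ K ∣ else 0) ≤ m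
  clique-term K with isClique G K in e
  ... | true  = bound K (isClique⇒IsClique G K e)
  ... | false = z≤n

p[x]≔outside⊆p : ∀ {n} (p : Subset n) x → p [ x ]≔ outside ⊆ p
p[x]≔outside⊆p (_ ∷ _) zero    (there y∈p)   = there y∈p
p[x]≔outside⊆p (_ ∷ _) (suc x) here          = here
p[x]≔outside⊆p (_ ∷ p) (suc x) (there y∈p′) = there (p[x]≔outside⊆p p x y∈p′)

x∉p[x]≔outside : ∀ {n} (p : Subset n) x → x ∉ p [ x ]≔ outside
x∉p[x]≔outside p x x∈p′ with trans (sym ([]=⇒lookup x∈p′)) ([]=⇒lookup ([]≔-updates p x))
... | ()

∣p∣≤1+∣p[x]≔outside∣ : ∀ {n} (p : Subset n) x → ∣ p ∣ ≤ suc ∣ p [ x ]≔ outside ∣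
∣p∣≤1+∣p[x]≔outside∣ (inside  ∷ p) zero    = ≤-refl
∣p∣≤1+∣p[x]≔outside∣ (outside ∷ p) zero    = n≤1+n ∣ p ∣
∣p∣≤1+∣p[x]≔outside∣ (inside  ∷ p) (suc x) = s≤s (∣p∣≤1+∣p[x]≔outside∣ p x)
∣p∣≤1+∣p[x]≔outside∣ (outside ∷ p) (suc x) = ∣p∣≤1+∣p[x]≔outside∣ p x

record EdgesLostWithin {n} (G H : Graph n) (p q r s : Fin n) : Set where
  field
    lost-edge : ∀ {i j} → adj G i j ≡ true → adj H i j ≡ false → SamePair i j p q ⊎ SamePair i j r s
open EdgesLostWithin

¬SamePair-outside : ∀ {n} {L : Subset n} {i j u v} → u ∉ L ⊎ v ∉ L → i ∈ L → j ∈ L → ¬ SamePair i j u v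
¬SamePair-outside (inj₁ u∉L) i∈L j∈L (inj₁ (refl , _)) = u∉L i∈L
¬SamePair-outside (inj₁ u∉L) i∈L j∈L (inj₂ (_ , refl)) = u∉L j∈L
¬SamePair-outside (inj₂ v∉L) i∈L j∈L (inj₁ (_ , refl)) = v∉L j∈L
¬SamePair-outside (inj₂ v∉L) i∈L j∈L (inj₂ (refl , _)) = v∉L i∈L

clique-avoiding-lost-edges : ∀ {n} {G H : Graph n} {p q r s} {K L : Subset n} →
  EdgesLostWithin G H p q r s → IsClique G K → L ⊆ K →
  p ∉ L ⊎ q ∉ L → r ∉ L ⊎ s ∉ L → IsClique H L
clique-avoiding-lost-edges {H = H} lost K-clique L⊆K pq∌ rs∌ {i} {j} i∈L j∈L i≢j
  with adj H i j in ij∉H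
... | true  = refl
... | false with lost-edge lost (K-clique (L⊆K i∈L) (L⊆K j∈L) i≢j) ij∉H
...   | inj₁ ij≐pq = contradiction ij≐pq (¬SamePair-outside pq∌ i∈L j∈L)
...   | inj₂ ij≐rs = contradiction ij≐rs (¬SamePair-outside rs∌ i∈L j∈L)

clique-minus-vertex : ∀ {n} {G H : Graph n} {p q r s} →
  EdgesLostWithin G H p q r s → q ≢ s → adj G q s ≡ false →
  ∀ {K} → IsClique G K → Σ (Fin n) λ v → IsClique H (K [ v ]≔ outside)
clique-minus-vertex {p = p} {q} {r} {s} lost q≢s qs∉G {K} K-clique with q ∈? K
... | yes q∈K = p , clique-avoiding-lost-edges lost K-clique (p[x]≔outside⊆p K p)
                      (inj₁ (x∉p[x]≔outside K p)) (inj₂ s∉L)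
  where
  s∉L : s ∉ K [ p ]≔ outside
  s∉L s∈L with trans (sym qs∉G) (K-clique q∈K (p[x]≔outside⊆p K p s∈L) q≢s)
  ... | ()
... | no q∉K  = r , clique-avoiding-lost-edges lost K-clique (p[x]≔outside⊆p K r)
                      (inj₂ (λ q∈L → q∉K (p[x]≔outside⊆p K r q∈L))) (inj₁ (x∉p[x]≔outside K r))

ω≤1+ω : ∀ {n} {G H : Graph n} {p q r s} →
  EdgesLostWithin G H p q r s → q ≢ s → adj G q s ≡ false → ω G ≤ suc (ω H)
ω≤1+ω {G = G} {H} lost q≢s qs∉G = ω-lub G λ K K-clique →
  let v , K-v-clique = clique-minus-vertex lost q≢s qs∉G K-clique
  in ≤-trans (∣p∣≤1+∣p[x]≔outside∣ K v) (s≤s (∣clique∣≤ω H K-v-clique))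

switched-loses : ∀ {n} (G : Graph n) a b c d → EdgesLostWithin G (switched G a b c d) a b c d
switched-loses G a b c d .lost-edge {i} {j} ij∈G ij∉H with i ≟ j
... | yes refl = contradiction refl (adjacent⇒≢ G ij∈G)
... | no _ with samePair i j a b in ij≐ab | samePair i j c d in ij≐cd
...   | true  | _    = inj₁ (samePair⇒SamePair ij≐ab)
...   | false | true = inj₂ (samePair⇒SamePair ij≐cd)
...   | false | false with samePair i j a c ∨ samePair i j b d
...     | true  = contradiction ij∉H λ ()
...     | false = contradiction (trans (sym ij∉H) ij∈G) λ ()

switched-gains : ∀ {n} (G : Graph n) a b c d → EdgesLostWithin (switched G a b c d) G c a d b
switched-gains G a b c d .lost-edge {i} {j} ij∈H ij∉G with i ≟ j
... | yes refl = contradiction ij∈H λ ()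
... | no _ with samePair i j a b ∨ samePair i j c d
...   | true = contradiction ij∈H λ ()
...   | false with samePair i j a c in ij≐ac | samePair i j b d in ij≐bd
...     | true  | _    = inj₁ (SamePair-sym (samePair⇒SamePair ij≐ac))
...     | false | true = inj₂ (SamePair-sym (samePair⇒SamePair ij≐bd))
...     | false | false = contradiction (trans (sym ij∉G) ij∈H) λ ()

switched-ab : ∀ {n} (G : Graph n) a b c d → adj (switched G a b c d) a b ≡ false
switched-ab G a b c d with a ≟ b
... | yes _ = refl
... | no _ rewrite ==-refl a | ==-refl b = refl

applicable⇒ : ∀ {n} (G : Graph n) a b c d → applicable G a b c d ≡ true →
  adj G a b ≡ true × b ≢ d × adj G b d ≡ false
applicable⇒ G a b c d app =
  let ab∈G , rest₁ = ∧≡true⇒ app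
      _ , rest₂ = ∧≡true⇒ {adj G c d} rest₁
      _ , rest₃ = ∧≡true⇒ {not (a == c)} rest₂
      _ , rest₄ = ∧≡true⇒ {not (a == d)} rest₃
      _ , rest₅ = ∧≡true⇒ {not (b == c)} rest₄
      b≠d , rest₆ = ∧≡true⇒ rest₅
      _ , bd∉G = ∧≡true⇒ {not (adj G a c)} rest₆
  in ab∈G , ==≡false⇒≢ (not≡true⇒ b≠d) , not≡true⇒ bd∉G

∣m-n∣≤1 : ∀ m n → m ≤ suc n → n ≤ suc m → ∣ m - n ∣ ≤ 1
∣m-n∣≤1 zero    n       _         n≤1   = n≤1
∣m-n∣≤1 (suc m) zero    m≤0       _     = m≤0
∣m-n∣≤1 (suc m) (suc n) (s≤s m≤n) (s≤s n≤m) = ∣m-n∣≤1 m n m≤n n≤m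

theorem14 : ∀ {n : ℕ} (G : Graph n) (a b c d : Fin n) →
    ∣ ω (twoSwitch a b c d G) - ω G ∣ ≤ 1
theorem14 G a b c d with applicable G a b c d in app
... | false rewrite ∣n-n∣≡0 (ω G) = z≤n
... | true with applicable⇒ G a b c d app
...   | ab∈G , b≢d , bd∉G = ∣m-n∣≤1 _ _
  (ω≤1+ω (switched-gains G a b c d) (adjacent⇒≢ G ab∈G) (switched-ab G a b c d))
  (ω≤1+ω (switched-loses G a b c d) b≢d bd∉G)
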